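{- Let $M$ be a map with a single zigzag and edge set $E$. If $x\in\mathcal{E}$ and $y\in\mathcal{O}$, then $b_P(x)\neq b_P(y)$.
   Context: A map $M$ is a graph $G_M$ with edge set $E=\{1,\dots,n\}$ cellularly embedded in a closed surface; it has a single zigzag (a closed walk alternately taking the leftmost and rightmost continuation at each vertex), which traverses each edge exactly twice, and the cyclic sequence of traversed edges is the Gauss code $\overline{P}$. An edge is black if the zigzag traverses it twice in the same direction, white otherwise. Identify subsets of $E$ with vectors in $\mathbb{Z}_2^E$ and $x$ with $\{x\}$. Linear maps on singletons: $i_{\overline{P}}(x)$ = set of edges occurring exactly once in $\overline{P}$ strictly between the two occurrences of $x$; $\kappa_P(x)=\{x\}$ if $x$ black, $\emptyset$ if white; $c_P=\kappa_P+i_{\overline{P}}$, $c_{P^\sim}=c_P+\mathrm{id}$, $b_P=c_{P^\sim}\circ c_P$. $\mathcal{O}=\{x\in E:|i_{\overline{P}}(x)|\text{ odd}\}$, $\mathcal{E}=E\setminus\mathcal{O}$. -}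

module Defs where

open import Data.Nat using (ℕ; zero; suc; _+_; _*_; _≡ᵇ_)
open import Data.Fin using (Fin; _≟_)
open import Data.Bool using (Bool; true; false; not; _∧_; _∨_; _xor_; if_then_else_)
open import Data.Product using (_×_; _,_; proj₁; proj₂)
open import Data.Vec using (Vec; tabulate; zipWith; lookup; foldr′)
open import Data.Fin.Subset using (Subset; ⁅_⁆; ⊥; ∣_∣)
open import Relation.Binary.PropositionalEquality using (_≡_; _≢_)
open import Relation.Nullary.Decidable using (⌊_⌋)

-- A flag of a map with edge set Fin n is (e , a , s): edge e, an end
-- a of e (which of its two vertex-incidences), and a side s of e.
-- τ₀ switches the end, τ₂ switches the side (these are fixed by the
-- labelling), τ₁ switches the edge at the same vertex and same face
-- corner.  A map (connected graph cellularly embedded in a closed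
-- surface) is exactly such a system with τ₁ a fixed-point-free
-- involution and ⟨τ₀,τ₁,τ₂⟩ transitive on flags.

Flag : ℕ → Set
Flag n = Fin n × Bool × Bool

τ₀ : ∀ {n} → Flag n → Flag n
τ₀ (e , a , s) = (e , not a , s)

τ₂ : ∀ {n} → Flag n → Flag n
τ₂ (e , a , s) = (e , a , not s)

edgeOf : ∀ {n} → Flag n → Fin n
edgeOf = proj₁

endOf : ∀ {n} → Flag n → Bool
endOf f = proj₁ (proj₂ f)

data Reach {n} (τ₁ : Flag n → Flag n) (f : Flag n) : Flag n → Set where
  here  : Reach τ₁ f f
  step₀ : ∀ {g} → Reach τ₁ f g → Reach τ₁ f (τ₀ g)
  step₁ : ∀ {g} → Reach τ₁ f g → Reach τ₁ f (τ₁ g)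
  step₂ : ∀ {g} → Reach τ₁ f g → Reach τ₁ f (τ₂ g)

record Map (n : ℕ) : Set where
  field
    τ₁        : Flag n → Flag n
    τ₁-invol  : ∀ f → τ₁ (τ₁ f) ≡ f
    τ₁-fpf    : ∀ f → τ₁ f ≢ f
    connected : ∀ f g → Reach τ₁ f g
open Map public

-- Zigzags (Petrie walks): orbits of ⟨τ₀τ₂, τ₁⟩.  A traversal of an
-- edge goes from flag f to τ₀ (τ₂ f) (leaving end `endOf f`); the next
-- traversal starts at τ₁ (τ₀ (τ₂ f)).

ζ : ∀ {n} → Map n → Flag n → Flag n
ζ M f = τ₁ M (τ₀ (τ₂ f))

data ZReach {n} (M : Map n) (f : Flag n) : Flag n → Set where
  here  : ZReach M f f
  stepα : ∀ {g} → ZReach M f g → ZReach M f (τ₀ (τ₂ g))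
  step₁ : ∀ {g} → ZReach M f g → ZReach M f (τ₁ M g)

SingleZigzag : ∀ {n} → Map n → Set
SingleZigzag M = ∀ f g → ZReach M f g

-- Gauss code read along the zigzag starting at flag f₀:
-- position k (0 ≤ k < 2n) is the k-th traversed edge.

iter : ∀ {A : Set} → ℕ → (A → A) → A → A
iter zero    h a = a
iter (suc k) h a = h (iter k h a)

flagAt : ∀ {n} → Map n → Flag n → ℕ → Flag n
flagAt M f₀ k = iter k (ζ M) f₀

code : ∀ {n} → Map n → Flag n → ℕ → Fin n
code M f₀ k = edgeOf (flagAt M f₀ k)

dir : ∀ {n} → Map n → Flag n → ℕ → Bool
dir M f₀ k = endOf (flagAt M f₀ k)

countB : ℕ → (ℕ → Bool) → ℕ
countB zero    p = 0
countB (suc m) p = countB m p + (if p m then 1 else 0)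

allB : ℕ → (ℕ → Bool) → Bool
allB zero    p = true
allB (suc m) p = allB m p ∧ p m

_⊕_ : ∀ {n} → Subset n → Subset n → Subset n
_⊕_ = zipWith _xor_

linExt : ∀ {n} → (Fin n → Subset n) → Subset n → Subset n
linExt {n} f S = foldr′ _⊕_ ⊥ (tabulate λ x → if lookup S x then f x else ⊥)

module GaussCode {n} (M : Map n) (f₀ : Flag n) where

  len : ℕ
  len = 2 * n

  occ : Fin n → ℕ → Bool
  occ x k = ⌊ code M f₀ k ≟ x ⌋

  between : Fin n → ℕ → Bool
  between x k = (countB k (occ x) ≡ᵇ 1) ∧ not (occ x k)

  iP : Fin n → Subset n
  iP x = tabulate λ y → countB len (λ k → between x k ∧ occ y k) ≡ᵇ 1

  black : Fin n → Bool
  black x = allB len λ k → allB len λ l →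
              not (occ x k ∧ occ x l) ∨ not (dir M f₀ k xor dir M f₀ l)

  κP : Fin n → Subset n
  κP x = if black x then ⁅ x ⁆ else ⊥

  cP : Fin n → Subset n
  cP x = κP x ⊕ iP x

  cP∼ : Fin n → Subset n
  cP∼ x = cP x ⊕ ⁅ x ⁆

  bP : Fin n → Subset n
  bP x = linExt cP∼ (cP x)

  InO : Fin n → Set
  InO x = Data.Nat._%_ ∣ iP x ∣ 2 ≡ 1

  InE : Fin n → Set
  InE x = Data.Nat._%_ ∣ iP x ∣ 2 ≡ 0

{-# OPTIONS --safe #-}
-- Work over ℤ₂ with c = c_P = κ_P + i_P̄, where κ_P is diagonal and i_P̄ has zero diagonal. Once
-- i_P̄ is symmetric, c is symmetric with c_xx = [x black], so b_P = (c + id) ∘ c = c² + c is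
-- symmetric with diagonal entries b_P(x)_x = Σ_z c_xz + c_xx = |i_P̄(x)| mod 2. If b_P(x) = b_P(y)
-- then b_P(x)_x = b_P(y)_x = b_P(x)_y = b_P(y)_y, so |i_P̄(x)| and |i_P̄(y)| have the same parity.
--
-- Symmetry of i_P̄ is the symmetry of interlacing of chords, valid as soon as the Gauss code read
-- over 2n steps contains every edge exactly twice. The zigzag is the ζ-orbit of f₀, and it meets
-- each pair {f, τ₀τ₂ f} exactly once per period: at least once because it is the only zigzag, at
-- most once because τ₀τ₂ conjugates ζ to ζ⁻¹, so meeting both flags of a pair produces a flag
-- fixed by τ₀τ₂ or by τ₁. Each edge carries two such pairs, and counting positions shows that the
-- period is 2n.
module Submission where

open import Defs
open import Algebra.Bundles using (CommutativeRing)
import Algebra.Properties.CommutativeSemigroup as CommutativeSemigroupProperties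
import Algebra.Properties.Semiring.Sum as SemiringSum
open import Data.Bool using (Bool; true; false; not; _∧_; _∨_; _xor_; if_then_else_; T)
open import Data.Bool.Properties
  using ( xor-∧-commutativeRing; ∧-comm; ∧-assoc; ∧-idem; ∧-zeroʳ; ∨-zeroʳ; ∧-identityʳ; ∧-inverseˡ
        ; ∧-distribˡ-∨; ∧-distribˡ-xor; xor-identityʳ; xor-comm; xor-assoc; xor-same; xor-annihilates-not
        ; not-involutive)
import Data.Bool.Properties as Bool
open import Data.Empty using () renaming (⊥-elim to absurd)
open import Data.Unit using (tt)
open import Data.Fin using (Fin; zero; suc; toℕ; _≟_)
open import Data.Fin.Properties using (*↔×; 2↔Bool; pigeonhole)
open import Data.Fin.Subset using (Subset; ⁅_⁆; ⊥; ∣_∣)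
open import Data.Nat using (ℕ; zero; suc; _+_; _*_; _<_; _≤_; s≤s; _%_; _/_; _≡ᵇ_; _<ᵇ_; _<?_)
  renaming (_≟_ to _≟ℕ_)
open import Data.Nat.DivMod using (%-distribˡ-+; m≡m%n+[m/n]*n; m%n<n)
open import Data.Nat.Induction using (<-rec)
open import Data.Nat.Properties
  using ( +-*-semiring; +-commutativeSemigroup; +-suc; +-comm; +-assoc; +-identityʳ; *-suc; *-comm; 0≢1+n
        ; <-irrefl; <-cmp; n<1+n; <-≤-trans; <⇒≤; ≤-refl; m<n⇒m<1+n; m≤n⇒∃[o]m+o≡n; m+n≤o⇒n≤o; anyUpTo?)
open import Data.Product using (∃; _×_; _,_; proj₂)
open import Data.Product.Function.NonDependent.Propositional using (_×-↔_)
open import Data.Product.Properties using (≡-dec)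
open import Data.Sum using (_⊎_; inj₁; inj₂)
import Data.Sum as Sum
open import Data.Vec using ([]; _∷_; lookup; tabulate; foldr′)
open import Data.Vec.Properties using (lookup-zipWith; lookup-replicate; lookup∘tabulate)
open import Function using (_∘_)
open import Function.Bundles using (_↣_; Injection)
open import Function.Properties.Inverse using (↔-sym; ↔-trans; ↔-refl; ↔⇒↣)
open import Relation.Binary.Definitions using (DecidableEquality; tri<; tri≈; tri>)
open import Relation.Binary.PropositionalEquality
open import Relation.Nullary using (¬_; yes; no; contradiction)
open import Relation.Nullary.Decidable using (⌊_⌋; ⌊⌋-map′; dec-true; dec-false; toWitness)
open import Relation.Unary using (Decidable)

open CommutativeSemigroupProperties (CommutativeRing.+-commutativeSemigroup xor-∧-commutativeRing)
  using () renaming (interchange to xor-interchange)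
open CommutativeSemigroupProperties +-commutativeSemigroup
  using () renaming (interchange to +-interchange)
open SemiringSum (CommutativeRing.semiring xor-∧-commutativeRing)
  using (sum; ∑-distrib-+; sum-cong-≗; sum-replicate-zero)
open SemiringSum +-*-semiring
  using ()
  renaming (sum to ∑ℕ; sum-cong-≗ to ∑ℕ-cong-≗; ∑-distrib-+ to ∑ℕ-distrib-+; sum-replicate-zero to ∑ℕ-zero)

-- Counting positions

𝟙 : Bool → ℕ
𝟙 b = if b then 1 else 0

𝟙-∨ : ∀ x y → x ∧ y ≡ false → 𝟙 (x ∨ y) ≡ 𝟙 x + 𝟙 y
𝟙-∨ true  false _ = refl
𝟙-∨ false y     _ = refl

𝟙+𝟙≡ᵇ1 : ∀ x y → (𝟙 x + 𝟙 y ≡ᵇ 1) ≡ x xor y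
𝟙+𝟙≡ᵇ1 true  true  = refl
𝟙+𝟙≡ᵇ1 true  false = refl
𝟙+𝟙≡ᵇ1 false true  = refl
𝟙+𝟙≡ᵇ1 false false = refl

≡ᵇ-refl : ∀ a → (a ≡ᵇ a) ≡ true
≡ᵇ-refl a = dec-true (a ≟ℕ a) refl

≢⇒≡ᵇ-false : ∀ {a b} → a ≢ b → (a ≡ᵇ b) ≡ false
≢⇒≡ᵇ-false {a} {b} = dec-false (a ≟ℕ b)

<⇒<ᵇ-true : ∀ {a b} → a < b → (a <ᵇ b) ≡ true
<⇒<ᵇ-true {a} {b} = dec-true (a <? b)

<ᵇ-irrefl : ∀ a → (a <ᵇ a) ≡ false
<ᵇ-irrefl a = dec-false (a <? a) (<-irrefl refl)

<ᵇ-suc : ∀ a N → (a <ᵇ suc N) ≡ (a ≡ᵇ N) ∨ (a <ᵇ N)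
<ᵇ-suc zero    zero    = refl
<ᵇ-suc zero    (suc N) = refl
<ᵇ-suc (suc a) zero    = refl
<ᵇ-suc (suc a) (suc N) = <ᵇ-suc a N

<ᵇ-flip : ∀ {a b} → a ≢ b → (b <ᵇ a) ≡ not (a <ᵇ b)
<ᵇ-flip {a} {b} a≢b with <-cmp a b
... | tri< a<b _ b≮a = trans (dec-false (b <? a) b≮a) (cong not (sym (<⇒<ᵇ-true a<b)))
... | tri≈ _ a≡b _   = contradiction a≡b a≢b
... | tri> a≮b _ b<a = trans (<⇒<ᵇ-true b<a) (cong not (sym (dec-false (a <? b) a≮b)))

countB-cong : ∀ N {f g : ℕ → Bool} → (∀ k → k < N → f k ≡ g k) → countB N f ≡ countB N g
countB-cong zero    f≗g = refl
countB-cong (suc N) f≗g = cong₂ _+_ (countB-cong N λ k k<N → f≗g k (m<n⇒m<1+n k<N)) (cong 𝟙 (f≗g N (n<1+n N)))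

countB-false : ∀ N {f : ℕ → Bool} → (∀ k → f k ≡ false) → countB N f ≡ 0
countB-false zero    f≡false = refl
countB-false (suc N) f≡false = cong₂ _+_ (countB-false N f≡false) (cong 𝟙 (f≡false N))

countB-∨ : ∀ N {f g : ℕ → Bool} → (∀ k → f k ∧ g k ≡ false) →
           countB N (λ k → f k ∨ g k) ≡ countB N f + countB N g
countB-∨ zero    disjoint = refl
countB-∨ (suc N) {f} {g} disjoint = begin
  countB N (λ k → f k ∨ g k) + 𝟙 (f N ∨ g N)
    ≡⟨ cong₂ _+_ (countB-∨ N disjoint) (𝟙-∨ (f N) (g N) (disjoint N)) ⟩
  (countB N f + countB N g) + (𝟙 (f N) + 𝟙 (g N))
    ≡⟨ +-interchange (countB N f) (countB N g) (𝟙 (f N)) (𝟙 (g N)) ⟩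
  (countB N f + 𝟙 (f N)) + (countB N g + 𝟙 (g N)) ∎
  where open ≡-Reasoning

countB-≡ᵇ : ∀ N a (h : ℕ → Bool) → countB N (λ k → h k ∧ (k ≡ᵇ a)) ≡ 𝟙 (h a ∧ (a <ᵇ N))
countB-≡ᵇ zero    a h = cong 𝟙 (sym (∧-zeroʳ (h a)))
countB-≡ᵇ (suc N) a h with N ≟ℕ a
... | yes refl = begin
  countB N (λ k → h k ∧ (k ≡ᵇ N)) + 𝟙 (h N ∧ (N ≡ᵇ N))
    ≡⟨ cong₂ _+_ (countB-≡ᵇ N N h) (cong (λ b → 𝟙 (h N ∧ b)) (≡ᵇ-refl N)) ⟩
  𝟙 (h N ∧ (N <ᵇ N)) + 𝟙 (h N ∧ true)
    ≡⟨ cong (λ b → 𝟙 (h N ∧ b) + 𝟙 (h N ∧ true)) (<ᵇ-irrefl N) ⟩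
  𝟙 (h N ∧ false) + 𝟙 (h N ∧ true)
    ≡⟨ cong (λ b → 𝟙 b + 𝟙 (h N ∧ true)) (∧-zeroʳ (h N)) ⟩
  𝟙 (h N ∧ true)
    ≡⟨ cong (λ b → 𝟙 (h N ∧ b)) (<⇒<ᵇ-true (n<1+n N)) ⟨
  𝟙 (h N ∧ (N <ᵇ suc N)) ∎
  where open ≡-Reasoning
... | no N≢a = begin
  countB N (λ k → h k ∧ (k ≡ᵇ a)) + 𝟙 (h N ∧ (N ≡ᵇ a))
    ≡⟨ cong₂ _+_ (countB-≡ᵇ N a h) (cong (λ b → 𝟙 (h N ∧ b)) (≢⇒≡ᵇ-false N≢a)) ⟩
  𝟙 (h a ∧ (a <ᵇ N)) + 𝟙 (h N ∧ false)
    ≡⟨ cong (λ b → 𝟙 (h a ∧ (a <ᵇ N)) + 𝟙 b) (∧-zeroʳ (h N)) ⟩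
  𝟙 (h a ∧ (a <ᵇ N)) + 0
    ≡⟨ +-identityʳ _ ⟩
  𝟙 (h a ∧ (a <ᵇ N))
    ≡⟨ cong (λ b → 𝟙 (h a ∧ (b ∨ (a <ᵇ N)))) (≢⇒≡ᵇ-false (N≢a ∘ sym)) ⟨
  𝟙 (h a ∧ ((a ≡ᵇ N) ∨ (a <ᵇ N)))
    ≡⟨ cong (λ b → 𝟙 (h a ∧ b)) (<ᵇ-suc a N) ⟨
  𝟙 (h a ∧ (a <ᵇ suc N)) ∎
  where open ≡-Reasoning

countB-pair : ∀ N {a b} (h : ℕ → Bool) → a ≢ b →
              countB N (λ k → h k ∧ ((k ≡ᵇ a) ∨ (k ≡ᵇ b))) ≡
              𝟙 (h a ∧ (a <ᵇ N)) + 𝟙 (h b ∧ (b <ᵇ N))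
countB-pair N {a} {b} h a≢b = begin
  countB N (λ k → h k ∧ ((k ≡ᵇ a) ∨ (k ≡ᵇ b)))
    ≡⟨ countB-cong N (λ k _ → ∧-distribˡ-∨ (h k) (k ≡ᵇ a) (k ≡ᵇ b)) ⟩
  countB N (λ k → h k ∧ (k ≡ᵇ a) ∨ h k ∧ (k ≡ᵇ b))
    ≡⟨ countB-∨ N disjoint ⟩
  countB N (λ k → h k ∧ (k ≡ᵇ a)) + countB N (λ k → h k ∧ (k ≡ᵇ b))
    ≡⟨ cong₂ _+_ (countB-≡ᵇ N a h) (countB-≡ᵇ N b h) ⟩
  𝟙 (h a ∧ (a <ᵇ N)) + 𝟙 (h b ∧ (b <ᵇ N)) ∎
  where
  open ≡-Reasoning
  disjoint : ∀ k → (h k ∧ (k ≡ᵇ a)) ∧ (h k ∧ (k ≡ᵇ b)) ≡ false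
  disjoint k with k ≟ℕ a
  ... | yes refl = begin
    (h k ∧ (k ≡ᵇ k)) ∧ (h k ∧ (k ≡ᵇ b)) ≡⟨ cong (λ c → (h k ∧ (k ≡ᵇ k)) ∧ (h k ∧ c)) (≢⇒≡ᵇ-false a≢b) ⟩
    (h k ∧ (k ≡ᵇ k)) ∧ (h k ∧ false)    ≡⟨ cong ((h k ∧ (k ≡ᵇ k)) ∧_) (∧-zeroʳ (h k)) ⟩
    (h k ∧ (k ≡ᵇ k)) ∧ false            ≡⟨ ∧-zeroʳ (h k ∧ (k ≡ᵇ k)) ⟩
    false                               ∎
  ... | no k≢a = trans (cong (λ c → (h k ∧ c) ∧ (h k ∧ (k ≡ᵇ b))) (≢⇒≡ᵇ-false k≢a))
                       (cong (_∧ (h k ∧ (k ≡ᵇ b))) (∧-zeroʳ (h k)))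

-- For a ∉ {p, q}: whether a lies strictly between p and q.
liesBetween : ℕ → ℕ → ℕ → Bool
liesBetween p q a = (p <ᵇ a) xor (q <ᵇ a)

liesBetween-interlace : ∀ {p q a b} → a ≢ p → a ≢ q → b ≢ p → b ≢ q →
  liesBetween p q a xor liesBetween p q b ≡ liesBetween a b p xor liesBetween a b q
liesBetween-interlace {p} {q} {a} {b} a≢p a≢q b≢p b≢q = begin
  ((p <ᵇ a) xor (q <ᵇ a)) xor ((p <ᵇ b) xor (q <ᵇ b))
    ≡⟨ xor-interchange (p <ᵇ a) (q <ᵇ a) (p <ᵇ b) (q <ᵇ b) ⟩
  ((p <ᵇ a) xor (p <ᵇ b)) xor ((q <ᵇ a) xor (q <ᵇ b))
    ≡⟨ cong₂ _xor_ (cong₂ _xor_ (<ᵇ-flip a≢p) (<ᵇ-flip b≢p))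
                   (cong₂ _xor_ (<ᵇ-flip a≢q) (<ᵇ-flip b≢q)) ⟩
  (not (a <ᵇ p) xor not (b <ᵇ p)) xor (not (a <ᵇ q) xor not (b <ᵇ q))
    ≡⟨ cong₂ _xor_ (xor-annihilates-not (a <ᵇ p) (b <ᵇ p)) (xor-annihilates-not (a <ᵇ q) (b <ᵇ q)) ⟩
  ((a <ᵇ p) xor (b <ᵇ p)) xor ((a <ᵇ q) xor (b <ᵇ q)) ∎
  where open ≡-Reasoning

≡ᵇ-∨-true : ∀ {k i j} → k ≡ i ⊎ k ≡ j → (k ≡ᵇ i) ∨ (k ≡ᵇ j) ≡ true
≡ᵇ-∨-true {k} {j = j} (inj₁ refl) = cong (_∨ (k ≡ᵇ j)) (≡ᵇ-refl k)
≡ᵇ-∨-true {k} {i}     (inj₂ refl) = trans (cong ((k ≡ᵇ i) ∨_) (≡ᵇ-refl k)) (∨-zeroʳ (k ≡ᵇ i))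

≡ᵇ-∨-false : ∀ {k i j} → k ≢ i → k ≢ j → (k ≡ᵇ i) ∨ (k ≡ᵇ j) ≡ false
≡ᵇ-∨-false k≢i k≢j = cong₂ _∨_ (≢⇒≡ᵇ-false k≢i) (≢⇒≡ᵇ-false k≢j)

record ExactlyTwice (N : ℕ) (f : ℕ → Bool) : Set where
  field
    first second : ℕ
    first≢second : first ≢ second
    first<N      : first < N
    second<N     : second < N
    f≡at-first∨second : ∀ k → k < N → f k ≡ (k ≡ᵇ first) ∨ (k ≡ᵇ second)

  countB-∧ : ∀ {M} (h : ℕ → Bool) → M ≤ N →
             countB M (λ k → h k ∧ f k) ≡ 𝟙 (h first ∧ (first <ᵇ M)) + 𝟙 (h second ∧ (second <ᵇ M))
  countB-∧ {M} h M≤N =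
    trans (countB-cong M λ k k<M → cong (h k ∧_) (f≡at-first∨second k (<-≤-trans k<M M≤N)))
          (countB-pair M h first≢second)

  countB≡2 : countB N f ≡ 2
  countB≡2 = trans (countB-∧ (λ _ → true) ≤-refl)
                   (cong₂ (λ x y → 𝟙 x + 𝟙 y) (<⇒<ᵇ-true first<N) (<⇒<ᵇ-true second<N))

  f-first : f first ≡ true
  f-first = trans (f≡at-first∨second first first<N) (≡ᵇ-∨-true {first} {first} {second} (inj₁ refl))

  f-second : f second ≡ true
  f-second = trans (f≡at-first∨second second second<N) (≡ᵇ-∨-true {second} {first} {second} (inj₂ refl))

-- Linear algebra over ℤ₂ on subsets

private variable
  m : ℕ

lookup-⊕ : (A B : Subset m) (w : Fin m) → lookup (A ⊕ B) w ≡ lookup A w xor lookup B w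
lookup-⊕ A B w = lookup-zipWith _xor_ w A B

∧-⁅⁆-comm : (g : Fin m → Bool) (u v : Fin m) → g u ∧ lookup ⁅ u ⁆ v ≡ g v ∧ lookup ⁅ v ⁆ u
∧-⁅⁆-comm g zero    zero    = refl
∧-⁅⁆-comm g zero    (suc v) =
  trans (cong (g zero ∧_) (lookup-replicate v false)) (trans (∧-zeroʳ (g zero)) (sym (∧-zeroʳ (g (suc v)))))
∧-⁅⁆-comm g (suc u) zero    = sym (∧-⁅⁆-comm g zero (suc u))
∧-⁅⁆-comm g (suc u) (suc v) = ∧-⁅⁆-comm (g ∘ suc) u v

lookup-⁅⁆-self : (u : Fin m) → lookup ⁅ u ⁆ u ≡ true
lookup-⁅⁆-self zero    = refl
lookup-⁅⁆-self (suc u) = lookup-⁅⁆-self u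

∑-select : (g : Fin m → Bool) (w : Fin m) → sum (λ z → g z ∧ lookup ⁅ z ⁆ w) ≡ g w
∑-select {suc m} g zero = begin
  g zero ∧ true xor sum (λ z → g (suc z) ∧ false)
    ≡⟨ cong₂ _xor_ (∧-identityʳ (g zero)) (trans (sum-cong-≗ (∧-zeroʳ ∘ g ∘ suc)) (sum-replicate-zero m)) ⟩
  g zero xor false
    ≡⟨ xor-identityʳ (g zero) ⟩
  g zero ∎
  where open ≡-Reasoning
∑-select {suc m} g (suc w) = begin
  g zero ∧ lookup ⁅ zero ⁆ (suc w) xor rest  ≡⟨ cong (λ b → g zero ∧ b xor rest) (lookup-replicate w false) ⟩
  g zero ∧ false xor rest                    ≡⟨ cong (_xor rest) (∧-zeroʳ (g zero)) ⟩
  rest                                       ≡⟨ ∑-select (g ∘ suc) w ⟩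
  g (suc w)                                  ∎
  where
  open ≡-Reasoning
  rest : Bool
  rest = sum (λ z → g (suc z) ∧ lookup ⁅ z ⁆ w)

lookup-∑ : ∀ {k} (G : Fin m → Subset k) (w : Fin k) →
           lookup (foldr′ _⊕_ ⊥ (tabulate G)) w ≡ sum (λ z → lookup (G z) w)
lookup-∑ {zero}  G w = lookup-replicate w false
lookup-∑ {suc m} G w = trans (lookup-⊕ (G zero) _ w) (cong (lookup (G zero) w xor_) (lookup-∑ (G ∘ suc) w))

lookup-if : ∀ b (A : Subset m) (w : Fin m) → lookup (if b then A else ⊥) w ≡ b ∧ lookup A w
lookup-if true  A w = refl
lookup-if false A w = lookup-replicate w false

lookup-linExt : (f : Fin m → Subset m) (S : Subset m) (w : Fin m) →
                lookup (linExt f S) w ≡ sum (λ z → lookup S z ∧ lookup (f z) w)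
lookup-linExt f S w = trans (lookup-∑ (λ z → if lookup S z then f z else ⊥) w)
                            (sum-cong-≗ λ z → lookup-if (lookup S z) (f z) w)

∣∣%2≡∑ : (S : Subset m) → ∣ S ∣ % 2 ≡ 𝟙 (sum (lookup S))
∣∣%2≡∑ []          = refl
∣∣%2≡∑ (false ∷ S) = ∣∣%2≡∑ S
∣∣%2≡∑ (true ∷ S)  =
  trans (%-distribˡ-+ 1 ∣ S ∣ 2) (trans (cong (λ r → suc r % 2) (∣∣%2≡∑ S)) (flip (sum (lookup S))))
  where
  flip : ∀ b → suc (𝟙 b) % 2 ≡ 𝟙 (not b)
  flip true  = refl
  flip false = refl

Symmetric : (Fin m → Subset m) → Set
Symmetric c = ∀ u v → lookup (c u) v ≡ lookup (c v) u

-- cP∼ is cP +id, so bP is linExt (cP +id) ∘ cP.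
_+id : (Fin m → Subset m) → Fin m → Subset m
(c +id) x = c x ⊕ ⁅ x ⁆

module _ (c : Fin m → Subset m) (c-sym : Symmetric c) where

  lookup-linExt-+id : ∀ u w → lookup (linExt (c +id) (c u)) w ≡
                      sum (λ z → lookup (c u) z ∧ lookup (c w) z) xor lookup (c u) w
  lookup-linExt-+id u w = begin
    lookup (linExt (c +id) (c u)) w
      ≡⟨ lookup-linExt (c +id) (c u) w ⟩
    sum (λ z → cu z ∧ lookup (c z ⊕ ⁅ z ⁆) w)
      ≡⟨ sum-cong-≗ (λ z → cong (cu z ∧_)
           (trans (lookup-⊕ (c z) ⁅ z ⁆ w) (cong (_xor lookup ⁅ z ⁆ w) (c-sym z w)))) ⟩
    sum (λ z → cu z ∧ (lookup (c w) z xor lookup ⁅ z ⁆ w))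
      ≡⟨ sum-cong-≗ (λ z → ∧-distribˡ-xor (cu z) _ _) ⟩
    sum (λ z → cu z ∧ lookup (c w) z xor cu z ∧ lookup ⁅ z ⁆ w)
      ≡⟨ ∑-distrib-+ (λ z → cu z ∧ lookup (c w) z) (λ z → cu z ∧ lookup ⁅ z ⁆ w) ⟩
    sum (λ z → cu z ∧ lookup (c w) z) xor sum (λ z → cu z ∧ lookup ⁅ z ⁆ w)
      ≡⟨ cong (sum (λ z → cu z ∧ lookup (c w) z) xor_) (∑-select cu w) ⟩
    sum (λ z → cu z ∧ lookup (c w) z) xor cu w ∎
    where
    open ≡-Reasoning
    cu : Fin m → Bool
    cu = lookup (c u)

  linExt-+id-symmetric : Symmetric (linExt (c +id) ∘ c)
  linExt-+id-symmetric u w = begin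
    lookup (linExt (c +id) (c u)) w                              ≡⟨ lookup-linExt-+id u w ⟩
    sum (λ z → lookup (c u) z ∧ lookup (c w) z) xor lookup (c u) w
      ≡⟨ cong₂ _xor_ (sum-cong-≗ λ z → ∧-comm (lookup (c u) z) _) (c-sym u w) ⟩
    sum (λ z → lookup (c w) z ∧ lookup (c u) z) xor lookup (c w) u ≡⟨ lookup-linExt-+id w u ⟨
    lookup (linExt (c +id) (c w)) u                              ∎
    where open ≡-Reasoning

  lookup-linExt-+id-self : ∀ u → lookup (linExt (c +id) (c u)) u ≡ sum (lookup (c u)) xor lookup (c u) u
  lookup-linExt-+id-self u =
    trans (lookup-linExt-+id u u) (cong (_xor lookup (c u) u) (sum-cong-≗ λ z → ∧-idem (lookup (c u) z)))

diagonal-cong : (b : Fin m → Subset m) → Symmetric b → ∀ {x y} → b x ≡ b y → lookup (b x) x ≡ lookup (b y) y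
diagonal-cong b b-sym {x} {y} bx≡by = begin
  lookup (b x) x ≡⟨ cong (λ S → lookup S x) bx≡by ⟩
  lookup (b y) x ≡⟨ b-sym y x ⟩
  lookup (b x) y ≡⟨ cong (λ S → lookup S y) bx≡by ⟩
  lookup (b y) y ∎
  where open ≡-Reasoning

-- The Gauss code of a single zigzag

∑ℕ-const : ∀ m k → ∑ℕ {m} (λ _ → k) ≡ m * k
∑ℕ-const zero    k = refl
∑ℕ-const (suc m) k = cong (k +_) (∑ℕ-const m k)

∑ℕ-𝟙-≟ : ∀ {m} (c : Fin m) → ∑ℕ (λ e → 𝟙 ⌊ c ≟ e ⌋) ≡ 1
∑ℕ-𝟙-≟ {suc m} zero    = cong suc (∑ℕ-zero m)
∑ℕ-𝟙-≟ {suc m} (suc c) = trans (∑ℕ-cong-≗ λ e → cong 𝟙 (⌊⌋-map′ _ _ (c ≟ e))) (∑ℕ-𝟙-≟ c)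

module _ {n} (M : Map n) (f₀ : Flag n) where
  open GaussCode M f₀

  occ-true : ∀ {e k} → occ e k ≡ true → code M f₀ k ≡ e
  occ-true {e} {k} occ≡true = toWitness {a? = code M f₀ k ≟ e} (subst T (sym occ≡true) tt)

  occ-disjoint : ∀ {u v j k} → u ≢ v → occ u j ≡ true → occ v k ≡ true → j ≢ k
  occ-disjoint {u} {v} {j} u≢v occ-u occ-v refl = u≢v (trans (sym (occ-true {u} {j} occ-u)) (occ-true {v} {j} occ-v))

  lookup-iP-self : ∀ u → lookup (iP u) u ≡ false
  lookup-iP-self u = trans (lookup∘tabulate _ u) (cong (_≡ᵇ 1) (countB-false len never))
    where
    never : ∀ k → between u k ∧ occ u k ≡ false
    never k = trans (∧-assoc (countB k (occ u) ≡ᵇ 1) (not (occ u k)) (occ u k))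
                    (trans (cong ((countB k (occ u) ≡ᵇ 1) ∧_) (∧-inverseˡ (occ u k))) (∧-zeroʳ _))

  between-outside : ∀ {u a} (t : ExactlyTwice len (occ u)) → let open ExactlyTwice t in
                    a < len → a ≢ first → a ≢ second → between u a ≡ liesBetween first second a
  between-outside {u} {a} t a<len a≢first a≢second = begin
    (countB a (occ u) ≡ᵇ 1) ∧ not (occ u a)
      ≡⟨ cong₂ (λ c o → (c ≡ᵇ 1) ∧ not o) (countB-∧ (λ _ → true) (<⇒≤ a<len))
               (trans (f≡at-first∨second a a<len) (≡ᵇ-∨-false a≢first a≢second)) ⟩
    (𝟙 (first <ᵇ a) + 𝟙 (second <ᵇ a) ≡ᵇ 1) ∧ true
      ≡⟨ ∧-identityʳ _ ⟩
    (𝟙 (first <ᵇ a) + 𝟙 (second <ᵇ a) ≡ᵇ 1)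
      ≡⟨ 𝟙+𝟙≡ᵇ1 (first <ᵇ a) (second <ᵇ a) ⟩
    liesBetween first second a ∎
    where
    open ≡-Reasoning
    open ExactlyTwice t

  lookup-iP-twice : ∀ u {v} (t : ExactlyTwice len (occ v)) → let open ExactlyTwice t in
                    lookup (iP u) v ≡ between u first xor between u second
  lookup-iP-twice u {v} t = begin
    lookup (iP u) v
      ≡⟨ lookup∘tabulate _ v ⟩
    (countB len (λ k → between u k ∧ occ v k) ≡ᵇ 1)
      ≡⟨ cong (_≡ᵇ 1) (countB-∧ (between u) ≤-refl) ⟩
    (𝟙 (between u first ∧ (first <ᵇ len)) + 𝟙 (between u second ∧ (second <ᵇ len)) ≡ᵇ 1)
      ≡⟨ cong₂ (λ x y → 𝟙 (between u first ∧ x) + 𝟙 (between u second ∧ y) ≡ᵇ 1)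
               (<⇒<ᵇ-true first<N) (<⇒<ᵇ-true second<N) ⟩
    (𝟙 (between u first ∧ true) + 𝟙 (between u second ∧ true) ≡ᵇ 1)
      ≡⟨ cong₂ (λ x y → 𝟙 x + 𝟙 y ≡ᵇ 1) (∧-identityʳ (between u first)) (∧-identityʳ (between u second)) ⟩
    (𝟙 (between u first) + 𝟙 (between u second) ≡ᵇ 1)
      ≡⟨ 𝟙+𝟙≡ᵇ1 (between u first) (between u second) ⟩
    between u first xor between u second ∎
    where
    open ≡-Reasoning
    open ExactlyTwice t

  iP-symmetric : (∀ e → ExactlyTwice len (occ e)) → Symmetric iP
  iP-symmetric twice u v with u ≟ v
  ... | yes refl = refl
  ... | no u≢v = begin
    lookup (iP u) v                           ≡⟨ lookup-iP-twice u (twice v) ⟩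
    between u a xor between u b               ≡⟨ cong₂ _xor_ (between-outside (twice u) a<len a≢p a≢q)
                                                             (between-outside (twice u) b<len b≢p b≢q) ⟩
    liesBetween p q a xor liesBetween p q b   ≡⟨ liesBetween-interlace a≢p a≢q b≢p b≢q ⟩
    liesBetween a b p xor liesBetween a b q   ≡⟨ cong₂ _xor_ (between-outside (twice v) p<len (a≢p ∘ sym) (b≢p ∘ sym))
                                                             (between-outside (twice v) q<len (a≢q ∘ sym) (b≢q ∘ sym)) ⟨
    between v p xor between v q               ≡⟨ lookup-iP-twice v (twice u) ⟨
    lookup (iP v) u                           ∎
    where
    open ≡-Reasoning
    open ExactlyTwice (twice u)
      renaming (first to p; second to q; first<N to p<len; second<N to q<len; f-first to occ-p; f-second to occ-q)
    open ExactlyTwice (twice v)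
      renaming (first to a; second to b; first<N to a<len; second<N to b<len; f-first to occ-a; f-second to occ-b)
    a≢p : a ≢ p
    a≢p = occ-disjoint (u≢v ∘ sym) occ-a occ-p
    a≢q : a ≢ q
    a≢q = occ-disjoint (u≢v ∘ sym) occ-a occ-q
    b≢p : b ≢ p
    b≢p = occ-disjoint (u≢v ∘ sym) occ-b occ-p
    b≢q : b ≢ q
    b≢q = occ-disjoint (u≢v ∘ sym) occ-b occ-q

  lookup-cP : ∀ u v → lookup (cP u) v ≡ black u ∧ lookup ⁅ u ⁆ v xor lookup (iP u) v
  lookup-cP u v = trans (lookup-⊕ (κP u) (iP u) v) (cong (_xor lookup (iP u) v) (lookup-if (black u) ⁅ u ⁆ v))

  cP-symmetric : Symmetric iP → Symmetric cP
  cP-symmetric iP-sym u v = begin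
    lookup (cP u) v                                   ≡⟨ lookup-cP u v ⟩
    black u ∧ lookup ⁅ u ⁆ v xor lookup (iP u) v      ≡⟨ cong₂ _xor_ (∧-⁅⁆-comm black u v) (iP-sym u v) ⟩
    black v ∧ lookup ⁅ v ⁆ u xor lookup (iP v) u      ≡⟨ lookup-cP v u ⟨
    lookup (cP v) u                                   ∎
    where open ≡-Reasoning

  ∑-cP : ∀ u → sum (lookup (cP u)) ≡ black u xor sum (lookup (iP u))
  ∑-cP u = begin
    sum (lookup (cP u))
      ≡⟨ sum-cong-≗ (lookup-cP u) ⟩
    sum (λ z → black u ∧ lookup ⁅ u ⁆ z xor lookup (iP u) z)
      ≡⟨ ∑-distrib-+ (λ z → black u ∧ lookup ⁅ u ⁆ z) (lookup (iP u)) ⟩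
    sum (λ z → black u ∧ lookup ⁅ u ⁆ z) xor sum (lookup (iP u))
      ≡⟨ cong (_xor sum (lookup (iP u)))
              (trans (sum-cong-≗ (∧-⁅⁆-comm (λ _ → black u) u)) (∑-select (λ _ → black u) u)) ⟩
    black u xor sum (lookup (iP u)) ∎
    where open ≡-Reasoning

  lookup-cP-self : ∀ u → lookup (cP u) u ≡ black u
  lookup-cP-self u = begin
    lookup (cP u) u                               ≡⟨ lookup-cP u u ⟩
    black u ∧ lookup ⁅ u ⁆ u xor lookup (iP u) u
      ≡⟨ cong₂ (λ x y → black u ∧ x xor y) (lookup-⁅⁆-self u) (lookup-iP-self u) ⟩
    black u ∧ true xor false                      ≡⟨ trans (xor-identityʳ _) (∧-identityʳ (black u)) ⟩
    black u                                       ∎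
    where open ≡-Reasoning

  bP-symmetric : Symmetric iP → Symmetric bP
  bP-symmetric iP-sym = linExt-+id-symmetric cP (cP-symmetric iP-sym)

  lookup-bP-self : Symmetric iP → ∀ u → lookup (bP u) u ≡ sum (lookup (iP u))
  lookup-bP-self iP-sym u = begin
    lookup (bP u) u                                ≡⟨ lookup-linExt-+id-self cP (cP-symmetric iP-sym) u ⟩
    sum (lookup (cP u)) xor lookup (cP u) u        ≡⟨ cong₂ _xor_ (∑-cP u) (lookup-cP-self u) ⟩
    (black u xor sum (lookup (iP u))) xor black u  ≡⟨ xor-comm (black u xor sum (lookup (iP u))) (black u) ⟩
    black u xor (black u xor sum (lookup (iP u)))  ≡⟨ xor-assoc (black u) (black u) (sum (lookup (iP u))) ⟨
    (black u xor black u) xor sum (lookup (iP u))  ≡⟨ cong (_xor sum (lookup (iP u))) (xor-same (black u)) ⟩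
    sum (lookup (iP u))                            ∎
    where open ≡-Reasoning

  ∑-countB-occ : ∀ N → ∑ℕ (λ e → countB N (occ e)) ≡ N
  ∑-countB-occ zero    = ∑ℕ-zero n
  ∑-countB-occ (suc N) = begin
    ∑ℕ (λ e → countB N (occ e) + 𝟙 (occ e N))
      ≡⟨ ∑ℕ-distrib-+ (λ e → countB N (occ e)) (λ e → 𝟙 (occ e N)) ⟩
    ∑ℕ (λ e → countB N (occ e)) + ∑ℕ (λ e → 𝟙 (occ e N))
      ≡⟨ cong₂ _+_ (∑-countB-occ N) (∑ℕ-𝟙-≟ (code M f₀ N)) ⟩
    N + 1
      ≡⟨ +-comm N 1 ⟩
    suc N ∎
    where open ≡-Reasoning

-- Each edge occurs exactly twice along a single zigzag

least-witness : {P : ℕ → Set} → Decidable P → ∃ P → ∃ λ k → P k × (∀ {j} → j < k → ¬ P j)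
least-witness {P} P? (d , Pd) = <-rec (λ d → P d → Least) search d Pd
  where
  Least : Set
  Least = ∃ λ k → P k × (∀ {j} → j < k → ¬ P j)
  search : ∀ d → (∀ {j} → j < d → P j → Least) → P d → Least
  search d smaller Pd with anyUpTo? P? d
  ... | yes (j , j<d , Pj) = smaller j<d Pj
  ... | no none            = d , Pd , λ j<d Pj → none (_ , j<d , Pj)

even-or-odd : ∀ d → ∃ λ t → d ≡ t + t ⊎ d ≡ suc (t + t)
even-or-odd zero    = 0 , inj₁ refl
even-or-odd (suc d) with even-or-odd d
... | t , inj₁ d≡t+t = t , inj₂ (cong suc d≡t+t)
... | t , inj₂ d≡1+t+t = suc t , inj₁ (cong suc (trans d≡1+t+t (sym (+-suc t t))))

iter-+ : ∀ {A : Set} k m (h : A → A) a → iter (k + m) h a ≡ iter k h (iter m h a)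
iter-+ zero    m h a = refl
iter-+ (suc k) m h a = cong h (iter-+ k m h a)

flag↣Fin : ∀ {n} → Flag n ↣ Fin (n * (2 * 2))
flag↣Fin = ↔⇒↣ (↔-sym (↔-trans *↔× (↔-refl ×-↔ ↔-trans *↔× (2↔Bool ×-↔ 2↔Bool))))

module _ {n : ℕ} where

  τ₀τ₂ : Flag n → Flag n
  τ₀τ₂ f = τ₀ (τ₂ f)

  τ₀τ₂-involutive : ∀ f → τ₀τ₂ (τ₀τ₂ f) ≡ f
  τ₀τ₂-involutive (e , a , s) = cong₂ (λ a s → e , a , s) (not-involutive a) (not-involutive s)

  τ₀τ₂-fixpoint-free : ∀ f → τ₀τ₂ f ≢ f
  τ₀τ₂-fixpoint-free (e , true  , s) ()
  τ₀τ₂-fixpoint-free (e , false , s) ()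

_≟Flag_ : ∀ {n} → DecidableEquality (Flag n)
_≟Flag_ = ≡-dec _≟_ (≡-dec Bool._≟_ Bool._≟_)

module Zigzag {n} (M : Map n) (f₀ : Flag n) where
  open GaussCode M f₀ using (occ; len)

  flag : ℕ → Flag n
  flag = flagAt M f₀

  ζ⁻¹ : Flag n → Flag n
  ζ⁻¹ f = τ₀τ₂ (τ₁ M f)

  ζ⁻¹-ζ : ∀ f → ζ⁻¹ (ζ M f) ≡ f
  ζ⁻¹-ζ f = trans (cong τ₀τ₂ (τ₁-invol M (τ₀τ₂ f))) (τ₀τ₂-involutive f)

  ζ-injective : ∀ {f g} → ζ M f ≡ ζ M g → f ≡ g
  ζ-injective {f} {g} ζf≡ζg = trans (sym (ζ⁻¹-ζ f)) (trans (cong ζ⁻¹ ζf≡ζg) (ζ⁻¹-ζ g))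

  flag-cancelˡ : ∀ i d → flag i ≡ flag (i + d) → f₀ ≡ flag d
  flag-cancelˡ zero    d eq = eq
  flag-cancelˡ (suc i) d eq = flag-cancelˡ i d (ζ-injective eq)

  returns : ∃ λ p → flag (suc p) ≡ f₀
  returns with pigeonhole (n<1+n (n * (2 * 2))) (Injection.to flag↣Fin ∘ flag ∘ toℕ)
  ... | i , j , i<j , same with m≤n⇒∃[o]m+o≡n i<j
  ... | d , 1+i+d≡j = d , sym (flag-cancelˡ (toℕ i) (suc d)
          (trans (Injection.injective flag↣Fin same) (cong flag (sym (trans (+-suc (toℕ i) d) 1+i+d≡j)))))

  first-return : ∃ λ p → flag (suc p) ≡ f₀ × (∀ {j} → j < p → flag (suc j) ≢ f₀)
  first-return = least-witness (λ p → flag (suc p) ≟Flag f₀) returns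

  -- τ₀τ₂ conjugates ζ to its inverse, so it reflects the zigzag onto itself.
  τ₀τ₂-reflects : ∀ t {a c} → τ₀τ₂ (flag a) ≡ flag (t + c) → τ₀τ₂ (flag (t + a)) ≡ flag c
  τ₀τ₂-reflects zero    eq = eq
  τ₀τ₂-reflects (suc t) {a} {c} eq =
    trans (cong ζ⁻¹ (τ₀τ₂-reflects t (trans eq (cong flag (sym (+-suc t c)))))) (ζ⁻¹-ζ (flag c))

  module Period {p : ℕ} (flag-P≡f₀ : flag (suc p) ≡ f₀)
                (no-earlier-return : ∀ {j} → j < p → flag (suc j) ≢ f₀) where

    P : ℕ
    P = suc p

    flag-+P : ∀ k → flag (k + P) ≡ flag k
    flag-+P k = trans (iter-+ k P (ζ M) f₀) (cong (iter k (ζ M)) flag-P≡f₀)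

    flag-+*P : ∀ r m → flag (r + m * P) ≡ flag r
    flag-+*P r zero    = cong flag (+-identityʳ r)
    flag-+*P r (suc m) = begin
      flag (r + (P + m * P)) ≡⟨ cong flag (trans (cong (r +_) (+-comm P (m * P))) (sym (+-assoc r (m * P) P))) ⟩
      flag (r + m * P + P)   ≡⟨ flag-+P (r + m * P) ⟩
      flag (r + m * P)       ≡⟨ flag-+*P r m ⟩
      flag r                 ∎
      where open ≡-Reasoning

    flag-%P : ∀ k → flag (k % P) ≡ flag k
    flag-%P k = trans (sym (flag-+*P (k % P) (k / P))) (cong flag (sym (m≡m%n+[m/n]*n k P)))

    flag-distinct : ∀ {i j} → i < j → j < P → flag i ≢ flag j
    flag-distinct {i} i<j (s≤s j≤p) eq with m≤n⇒∃[o]m+o≡n i<j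
    ... | d , refl = no-earlier-return (m+n≤o⇒n≤o i (subst (_≤ p) (sym (+-suc i d)) j≤p))
                                       (sym (flag-cancelˡ i (suc d) (trans eq (cong flag (sym (+-suc i d))))))

    flag-injective : ∀ {i j} → i < P → j < P → flag i ≡ flag j → i ≡ j
    flag-injective {i} {j} i<P j<P eq with <-cmp i j
    ... | tri< i<j _ _ = absurd (flag-distinct i<j j<P eq)
    ... | tri≈ _ i≡j _ = i≡j
    ... | tri> _ _ j<i = absurd (flag-distinct j<i i<P (sym eq))

    flag-+a*P : ∀ a b → flag b ≡ flag (b + a * p + a)
    flag-+a*P a b = begin
      flag b               ≡⟨ flag-+*P b a ⟨
      flag (b + a * P)     ≡⟨ cong (λ x → flag (b + x)) (trans (*-suc a p) (+-comm a (a * p))) ⟩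
      flag (b + (a * p + a)) ≡⟨ cong flag (+-assoc b (a * p) a) ⟨
      flag (b + a * p + a) ∎
      where open ≡-Reasoning

    -- Reflecting the zigzag about the midpoint of a and b (mod P) fixes a flag under τ₀τ₂ or under τ₁.
    τ₀τ₂-flag-≢-flag : ∀ a b → τ₀τ₂ (flag a) ≢ flag b
    τ₀τ₂-flag-≢-flag a b eq with even-or-odd (b + a * p)
    ... | t , inj₁ d≡t+t =
      τ₀τ₂-fixpoint-free (flag (t + a))
        (τ₀τ₂-reflects t (trans eq (trans (flag-+a*P a b) (cong flag d+a≡t+[t+a]))))
      where
      d+a≡t+[t+a] : b + a * p + a ≡ t + (t + a)
      d+a≡t+[t+a] = trans (cong (_+ a) d≡t+t) (+-assoc t t a)
    ... | t , inj₂ d≡1+t+t =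
      τ₁-fpf M (τ₀τ₂ (flag (t + a)))
        (sym (τ₀τ₂-reflects t (trans eq (trans (flag-+a*P a b) (cong flag d+a≡t+[1+t+a])))))
      where
      d+a≡t+[1+t+a] : b + a * p + a ≡ t + suc (t + a)
      d+a≡t+[1+t+a] = trans (cong (_+ a) d≡1+t+t) (trans (cong suc (+-assoc t t a)) (sym (+-suc t (t + a))))

    data Traverses (k : ℕ) (g : Flag n) : Set where
      direct   : flag k ≡ g → Traverses k g
      opposite : flag k ≡ τ₀τ₂ g → Traverses k g

    Traversed : Flag n → Set
    Traversed g = ∃ λ k → Traverses k g

    traversed-τ₀τ₂ : ∀ {g} → Traversed g → Traversed (τ₀τ₂ g)
    traversed-τ₀τ₂ {g} (k , direct eq) = k , opposite (trans eq (sym (τ₀τ₂-involutive g)))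
    traversed-τ₀τ₂     (k , opposite eq) = k , direct eq

    traversed-τ₁ : ∀ {g} → Traversed g → Traversed (τ₁ M g)
    traversed-τ₁ {g} (k , direct eq) = k + p , opposite (begin
      flag (k + p)               ≡⟨ ζ⁻¹-ζ (flag (k + p)) ⟨
      ζ⁻¹ (flag (suc (k + p)))   ≡⟨ cong (ζ⁻¹ ∘ flag) (+-suc k p) ⟨
      ζ⁻¹ (flag (k + P))         ≡⟨ cong ζ⁻¹ (trans (flag-+P k) eq) ⟩
      τ₀τ₂ (τ₁ M g)              ∎)
      where open ≡-Reasoning
    traversed-τ₁ {g} (k , opposite eq) = suc k , direct (cong (τ₁ M) (trans (cong τ₀τ₂ eq) (τ₀τ₂-involutive g)))

    traversed-reachable : ∀ {g} → ZReach M f₀ g → Traversed g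
    traversed-reachable here      = 0 , direct refl
    traversed-reachable (stepα r) = traversed-τ₀τ₂ (traversed-reachable r)
    traversed-reachable (step₁ r) = traversed-τ₁ (traversed-reachable r)

    traversed : SingleZigzag M → ∀ g → ∃ λ k → k < P × Traverses k g
    traversed single g with traversed-reachable (single f₀ g)
    ... | k , direct eq   = k % P , m%n<n k P , direct (trans (flag-%P k) eq)
    ... | k , opposite eq = k % P , m%n<n k P , opposite (trans (flag-%P k) eq)

    traversal-unique : ∀ {i j g} → i < P → j < P → Traverses i g → Traverses j g → i ≡ j
    traversal-unique i<P j<P (direct eqᵢ)   (direct eqⱼ)   = flag-injective i<P j<P (trans eqᵢ (sym eqⱼ))
    traversal-unique i<P j<P (opposite eqᵢ) (opposite eqⱼ) = flag-injective i<P j<P (trans eqᵢ (sym eqⱼ))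
    traversal-unique {i} {j} _ _ (direct eqᵢ) (opposite eqⱼ) =
      absurd (τ₀τ₂-flag-≢-flag i j (trans (cong τ₀τ₂ eqᵢ) (sym eqⱼ)))
    traversal-unique {i} {j} _ _ (opposite eqᵢ) (direct eqⱼ) =
      absurd (τ₀τ₂-flag-≢-flag j i (trans (cong τ₀τ₂ eqⱼ) (sym eqᵢ)))

    diagonal : Flag n → Bool
    diagonal (_ , a , s) = a xor s

    traverses-diagonal : ∀ {k g} → Traverses k g → diagonal (flag k) ≡ diagonal g
    traverses-diagonal         (direct eq)   = cong diagonal eq
    traverses-diagonal {g = g} (opposite eq) = trans (cong diagonal eq) (xor-annihilates-not (endOf g) (proj₂ (proj₂ g)))

    traverses-edge : ∀ {k g} → Traverses k g → code M f₀ k ≡ edgeOf g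
    traverses-edge (direct eq)   = cong edgeOf eq
    traverses-edge (opposite eq) = cong edgeOf eq

    traverses-class : ∀ {e} k → code M f₀ k ≡ e → Traverses k (e , false , false) ⊎ Traverses k (e , false , true)
    traverses-class k codeₖ≡e with flag k in eq | codeₖ≡e
    ... | _ , false , false | refl = inj₁ (direct eq)
    ... | _ , true  , true  | refl = inj₁ (opposite eq)
    ... | _ , false , true  | refl = inj₂ (direct eq)
    ... | _ , true  , false | refl = inj₂ (opposite eq)

    occurrences : SingleZigzag M → ∀ e → ExactlyTwice P (occ e)
    occurrences single e with traversed single (e , false , false) | traversed single (e , false , true)
    ... | i , i<P , tᵢ | j , j<P , tⱼ = record
      { first = i ; second = j ; first≢second = i≢j ; first<N = i<P ; second<N = j<P
      ; f≡at-first∨second = occ≡ }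
      where
      i≢j : i ≢ j
      i≢j refl with trans (sym (traverses-diagonal tᵢ)) (traverses-diagonal tⱼ)
      ... | ()
      occ≡ : ∀ k → k < P → occ e k ≡ (k ≡ᵇ i) ∨ (k ≡ᵇ j)
      occ≡ k k<P with code M f₀ k ≟ e
      ... | yes codeₖ≡e = sym (≡ᵇ-∨-true (Sum.map (λ tₖ → traversal-unique k<P i<P tₖ tᵢ)
                                                 (λ tₖ → traversal-unique k<P j<P tₖ tⱼ)
                                                 (traverses-class k codeₖ≡e)))
      ... | no codeₖ≢e =
        sym (≡ᵇ-∨-false {k} {i} {j} (λ { refl → codeₖ≢e (traverses-edge tᵢ) })
                                    (λ { refl → codeₖ≢e (traverses-edge tⱼ) }))

    P≡len : SingleZigzag M → P ≡ len
    P≡len single = begin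
      P                            ≡⟨ ∑-countB-occ M f₀ P ⟨
      ∑ℕ (λ e → countB P (occ e))  ≡⟨ ∑ℕ-cong-≗ (ExactlyTwice.countB≡2 ∘ occurrences single) ⟩
      ∑ℕ {n} (λ _ → 2)             ≡⟨ ∑ℕ-const n 2 ⟩
      n * 2                        ≡⟨ *-comm n 2 ⟩
      2 * n                        ∎
      where open ≡-Reasoning

double-occurrence : ∀ {n} (M : Map n) → SingleZigzag M → (f₀ : Flag n) →
                    ∀ e → ExactlyTwice (GaussCode.len M f₀) (GaussCode.occ M f₀ e)
double-occurrence M single f₀ e with Zigzag.first-return M f₀
... | _ , flag-P≡f₀ , no-earlier-return =
  subst (λ N → ExactlyTwice N (GaussCode.occ M f₀ e)) (P≡len single) (occurrences single e)
  where open Zigzag M f₀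
        open Period flag-P≡f₀ no-earlier-return

proposition7 : ∀ {n} (M : Map n) → SingleZigzag M → (f₀ : Flag n) →
    (x y : Fin n) → GaussCode.InE M f₀ x → GaussCode.InO M f₀ y →
    GaussCode.bP M f₀ x ≢ GaussCode.bP M f₀ y
proposition7 M single f₀ x y x∈ℰ y∈𝒪 bPx≡bPy = 0≢1+n (begin
  0                        ≡⟨ x∈ℰ ⟨
  ∣ iP x ∣ % 2             ≡⟨ ∣∣%2≡∑ (iP x) ⟩
  𝟙 (sum (lookup (iP x)))  ≡⟨ cong 𝟙 (lookup-bP-self M f₀ iP-sym x) ⟨
  𝟙 (lookup (bP x) x)      ≡⟨ cong 𝟙 (diagonal-cong bP (bP-symmetric M f₀ iP-sym) bPx≡bPy) ⟩
  𝟙 (lookup (bP y) y)      ≡⟨ cong 𝟙 (lookup-bP-self M f₀ iP-sym y) ⟩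
  𝟙 (sum (lookup (iP y)))  ≡⟨ ∣∣%2≡∑ (iP y) ⟨
  ∣ iP y ∣ % 2             ≡⟨ y∈𝒪 ⟩
  1                        ∎)
  where
  open ≡-Reasoning
  open GaussCode M f₀
  iP-sym : Symmetric iP
  iP-sym = iP-symmetric M f₀ (double-occurrence M single f₀)
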